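{- Let $n\ge 7$ be an integer, let $\rho$ be the element of $\mathcal{E}$ with $\rho\ge 5/\log 5$ and $\ell(N_\rho)\le n<\ell(N_\rho^+)$, and let $N=N_\rho$. Let $M$ be a positive integer with $\ell(M)\le n$. Then \[\mathrm{ben}(g(n))\le \mathrm{ben}(M)+\ell(g(n))-\ell(M)\] and \[\mathrm{ben}(g(n))\le \mathrm{ben}(g(n))+n-\ell(g(n))\le \mathrm{ben}(M)+n-\ell(M).\]
   Context: For a positive integer $M=q_1^{\alpha_1}\cdots q_k^{\alpha_k}$ (standard factorization), $\ell(M)=q_1^{\alpha_1}+\dots+q_k^{\alpha_k}$, $\ell(1)=0$. $g(n)=\max\{M\ge1:\ell(M)\le n\}$. $\mathcal{E}=\{p/\log p: p\text{ prime}\}\cup\{(p^{i+1}-p^i)/\log p: p\text{ prime}, i\ge1\}$. A positive integer $N$ is an $\ell$-superchampion associated to $\rho>0$ if $\ell(M')-\rho\log M'\ge\ell(N)-\rho\log N$ for all $M'\ge1$; $N_\rho$ and $N_\rho^+$ denote the smallest and largest $\ell$-superchampions associated to $\rho$ (there is exactly one $\rho$ as described for each $n\ge 7$). The benefit of a positive integer $M$ is $\mathrm{ben}(M)=\ell(M)-\ell(N)-\rho\log(M/N)$, which is non-negative. -}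

module Defs where

open import Data.Nat using (ℕ; zero; suc; _+_; _*_; _∸_; _^_; _≤_; _<_; _≥_)
open import Data.Nat.Divisibility using (_∣_; _∣?_; divides)
open import Data.Nat.Primality using (Prime; prime?)
open import Data.List using (List; map; upTo)
open import Data.Nat.ListAction using (sum)
open import Data.Bool using (if_then_else_; _∧_)
open import Data.Product using (_×_; _,_; ∃-syntax)
open import Data.Sum using (_⊎_)
open import Relation.Nullary using (does; yes; no)
open import Relation.Binary.PropositionalEquality using (_≡_)

-- p-adic valuation of m, computed with fuel (fuel = m suffices for m ≥ 1)
val : ℕ → ℕ → ℕ → ℕ
val zero    p m = 0
val (suc f) p zero = 0
val (suc f) p (suc m) with p ∣? suc m
... | yes (divides q _) = suc (val f p q)
... | no  _             = 0

-- ℓ(M) = sum of the prime powers q^α in the standard factorization of M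
-- (ℓ(1) = 0; the value at 0 is irrelevant and never used)
ℓ : ℕ → ℕ
ℓ M = sum (map term (upTo (suc M)))
  where
  term : ℕ → ℕ
  term q = if does (prime? q) ∧ does (q ∣? M) then q ^ val M q M else 0

-- g(n) = max{ M ≥ 1 : ℓ(M) ≤ n }, expressed as "G is that maximum"
IsG : ℕ → ℕ → Set
IsG n G = 1 ≤ G × ℓ G ≤ n × (∀ M → 1 ≤ M → ℓ M ≤ n → M ≤ G)

-- Representation of ρ = a / log p  (p prime, a ∈ ℕ).
-- ρ ∈ ℰ  iff  a = p, or a = p^(i+1) - p^i for some i ≥ 1.
InE : ℕ → ℕ → Set
InE p a = Prime p × (a ≡ p ⊎ ∃[ i ] (1 ≤ i × a ≡ p ^ suc i ∸ p ^ i))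

-- ρ ≥ 5 / log 5  ⇔  a·log 5 ≥ 5·log p  ⇔  5^a ≥ p^5
RhoGe5 : ℕ → ℕ → Set
RhoGe5 p a = p ^ 5 ≤ 5 ^ a

-- N is an ℓ-superchampion associated to ρ = a/log p:
-- ∀ M' ≥ 1, ℓ(M') - ρ log M' ≥ ℓ(N) - ρ log N
-- ⇔ (after multiplying by log p > 0 and exponentiating)
--   p^ℓ(N) · M'^a ≤ p^ℓ(M') · N^a
IsSuperchampion : ℕ → ℕ → ℕ → Set
IsSuperchampion p a N =
  1 ≤ N × (∀ M' → 1 ≤ M' → p ^ ℓ N * M' ^ a ≤ p ^ ℓ M' * N ^ a)

IsNρ : ℕ → ℕ → ℕ → Set
IsNρ p a N = IsSuperchampion p a N × (∀ N' → IsSuperchampion p a N' → N ≤ N')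

IsNρ⁺ : ℕ → ℕ → ℕ → Set
IsNρ⁺ p a N = IsSuperchampion p a N × (∀ N' → IsSuperchampion p a N' → N' ≤ N)

-- "Log-scaled" real quantities: the pair (u , v) (u, v ≥ 1) stands for the
-- real number (log u - log v) / log p.  All quantities in the statement are
-- of this shape (for fixed p), so they are handled exactly.
LogVal : Set
LogVal = ℕ × ℕ

_⊕_ : LogVal → LogVal → LogVal
(u , v) ⊕ (u' , v') = (u * u' , v * v')

infixl 6 _⊕_
infix 4 _≤L_

_≤L_ : LogVal → LogVal → Set
(u , v) ≤L (u' , v') = u * v' ≤ u' * v

-- the integer k - m (as the real number k - m = (log p^k - log p^m)/log p)
diffL : ℕ → ℕ → ℕ → LogVal
diffL p k m = (p ^ k , p ^ m)

-- ben(M) = ℓ(M) - ℓ(N) - ρ log(M/N), with ρ = a / log p: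
-- ben(M) = (log (p^ℓ(M) · N^a) - log (p^ℓ(N) · M^a)) / log p
ben : ℕ → ℕ → ℕ → ℕ → LogVal
ben p a N M = (p ^ ℓ M * N ^ a , p ^ ℓ N * M ^ a)

{-# OPTIONS --safe #-}
module Submission where

-- g(n) is the largest integer with ℓ ≤ n, so M ≤ g(n) and ℓ(g(n)) ≤ n. Up to a term
-- independent of M, ben(M) + ℓ(M) is -ρ log M, which decreases in M: this gives the first
-- and third inequalities. The second one is n - ℓ(g(n)) ≥ 0.

open import Defs
open import Data.Nat using (ℕ; _≤_; _<_; _*_; _^_)
open import Data.Nat.Properties using (*-monoʳ-≤; ^-monoˡ-≤; ^-monoʳ-≤)
open import Data.Nat.Primality using (prime⇒nonZero)
open import Data.Product using (_×_; _,_)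
open import Relation.Binary.PropositionalEquality using (_≡_; refl; subst₂)
open import Data.Nat.Solver using (module +-*-Solver)
open +-*-Solver

≤L-⊕-increasingʳ : ∀ x {u v} → v ≤ u → x ≤L x ⊕ (u , v)
≤L-⊕-increasingʳ (s , t) {u} {v} v≤u =
  subst₂ _≤_ (left s t v) (right s t u) (*-monoʳ-≤ (s * t) v≤u)
  where
  left : ∀ s t w → s * t * w ≡ s * (t * w)
  left = solve 3 (λ s t w → s :* t :* w := s :* (t :* w)) refl
  right : ∀ s t w → s * t * w ≡ s * w * t
  right = solve 3 (λ s t w → s :* t :* w := s :* w :* t) refl

module _ (p a N : ℕ) {M G : ℕ} (Mᵃ≤Gᵃ : M ^ a ≤ G ^ a) where

  ben-≤L-ben-⊕-diffL : ben p a N G ≤L ben p a N M ⊕ diffL p (ℓ G) (ℓ M)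
  ben-≤L-ben-⊕-diffL =
    subst₂ _≤_ (left (p ^ ℓ G) (N ^ a) (p ^ ℓ N) (p ^ ℓ M) (M ^ a))
               (right (p ^ ℓ G) (N ^ a) (p ^ ℓ N) (p ^ ℓ M) (G ^ a))
               (*-monoʳ-≤ (p ^ ℓ G * N ^ a * p ^ ℓ N * p ^ ℓ M) Mᵃ≤Gᵃ)
    where
    left : ∀ s t c d w → s * t * c * d * w ≡ s * t * (c * w * d)
    left = solve 5 (λ s t c d w → s :* t :* c :* d :* w := s :* t :* (c :* w :* d)) refl
    right : ∀ s t c d w → s * t * c * d * w ≡ d * t * s * (c * w)
    right = solve 5 (λ s t c d w → s :* t :* c :* d :* w := d :* t :* s :* (c :* w)) refl

  ben-⊕-diffL-antitone : ∀ n → ben p a N G ⊕ diffL p n (ℓ G) ≤L ben p a N M ⊕ diffL p n (ℓ M)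
  ben-⊕-diffL-antitone n =
    subst₂ _≤_ (left (p ^ ℓ G) (N ^ a) (p ^ ℓ N) (p ^ ℓ M) (p ^ n) (M ^ a))
               (right (p ^ ℓ G) (N ^ a) (p ^ ℓ N) (p ^ ℓ M) (p ^ n) (G ^ a))
               (*-monoʳ-≤ (p ^ ℓ G * N ^ a * p ^ ℓ N * p ^ ℓ M * p ^ n) Mᵃ≤Gᵃ)
    where
    left : ∀ s t c d e w → s * t * c * d * e * w ≡ s * t * e * (c * w * d)
    left = solve 6 (λ s t c d e w → s :* t :* c :* d :* e :* w
                                   := s :* t :* e :* (c :* w :* d)) refl
    right : ∀ s t c d e w → s * t * c * d * e * w ≡ d * t * e * (c * w * s)
    right = solve 6 (λ s t c d e w → s :* t :* c :* d :* e :* w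
                                    := d :* t :* e :* (c :* w :* s)) refl

proposition2 : (n : ℕ) → 7 ≤ n → (p a : ℕ) → InE p a → RhoGe5 p a
    → (N N⁺ : ℕ) → IsNρ p a N → IsNρ⁺ p a N⁺ → ℓ N ≤ n → n < ℓ N⁺
    → (G : ℕ) → IsG n G
    → (M : ℕ) → 1 ≤ M → ℓ M ≤ n
    → (ben p a N G ≤L ben p a N M ⊕ diffL p (ℓ G) (ℓ M))
    × (ben p a N G ≤L ben p a N G ⊕ diffL p n (ℓ G))
    × (ben p a N G ⊕ diffL p n (ℓ G) ≤L ben p a N M ⊕ diffL p n (ℓ M))
proposition2 n _ p a (p-prime , _) _ N _ _ _ _ _ G (_ , ℓG≤n , G-max) M 1≤M ℓM≤n =
    ben-≤L-ben-⊕-diffL p a N Mᵃ≤Gᵃ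
  , ≤L-⊕-increasingʳ (ben p a N G) (^-monoʳ-≤ p {{prime⇒nonZero p-prime}} ℓG≤n)
  , ben-⊕-diffL-antitone p a N Mᵃ≤Gᵃ n
  where
  Mᵃ≤Gᵃ : M ^ a ≤ G ^ a
  Mᵃ≤Gᵃ = ^-monoˡ-≤ a (G-max M 1≤M ℓM≤n)
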